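{- Let $t$ be a hereditarily defined term. For any term $t'$, if $\bar t\to^*t'$, then $t'\!\downarrow\;=\bar t_0$ for some term $t_0$ such that $t\to^*t_0$.
   Context: The lambda calculus with constructors ($\lambda_C$). Fix constructors $\{c_1,\dots,c_n\}$ ($n\ge1$). Terms: $t,u::=x\mid tu\mid\lambda x.t\mid c\mid\{\theta\}\cdot t$, case-bindings $\theta=\{d_1\mapsto u_1;\dots;d_k\mapsto u_k\}$ ($k\ge0$, pairwise distinct constructors), $\mathrm{dom}(\theta)=\{d_1,\dots,d_k\}$; terms up to $\alpha$-conversion. $\theta\circ\{d_j\mapsto t_j\}_j=\{d_j\mapsto\{\theta\}\cdot t_j\}_j$. $\to$ is the contextual closure (also inside case-bindings) of: (AppLam) $(\lambda x.t)u\to t[x:=u]$; (LamApp) $\lambda x.t\,x\to t$ if $x\notin FV(t)$; (CaseCons) $\{\theta\}\cdot c\to t$ if $(c\mapsto t)\in\theta$; (CaseApp) $\{\theta\}\cdot(tu)\to(\{\theta\}\cdot t)u$; (CaseLam) $\{\theta\}\cdot\lambda x.t\to\lambda x.\{\theta\}\cdot t$ if $x\notin FV(\theta)$; (CaseCase) $\{\theta\}\cdot\{\phi\}\cdot t\to\{\theta\circ\phi\}\cdot t$; $\to^*$ its reflexive transitive closure. The contextual closure of CaseCase alone is confluent and strongly normalising (known facts); $t\!\downarrow$ denotes the unique normal form of $t$ for it. A match failure is $\{\theta\}\cdot c$ with $c\notin\mathrm{dom}(\theta)$; a term is defined if no subterm is a match failure, hereditarily defined if all its reducts (zero or more steps)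 are defined. Case-completion: $\bar x=x$, $\bar c=c$, $\overline{\lambda x.t}=\lambda x.\bar t$, $\overline{tu}=\bar t\,\bar u$, $\overline{\{\theta\}\cdot t}=\{\bar\theta\}\cdot\bar t$, where $\bar\theta=\{c_i\mapsto u'_i\mid1\le i\le n\}$ with $u'_i=\bar u_i$ if $(c_i\mapsto u_i)\in\theta$ and $u'_i=\{\}\cdot c_1$ (empty case-binding applied to $c_1$) if $c_i\notin\mathrm{dom}(\theta)$. -}

module Defs where

open import Data.Nat using (ℕ; zero; suc)
open import Data.Fin using (Fin; zero; suc)
open import Data.Maybe using (Maybe; just; nothing)
open import Data.Vec using (Vec; []; _∷_; lookup; replicate)
import Data.Vec as Vec
import Data.Maybe as Maybe
open import Data.Product using (_×_; ∃)
open import Relation.Nullary using (¬_)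
open import Relation.Binary.PropositionalEquality using (_≡_)
open import Relation.Binary.Construct.Closure.ReflexiveTransitive using (Star)

-- Lambda calculus with constructors, for n = suc m ≥ 1 constructors.
-- Constructors are Fin (suc m); c₁ is `zero`.
-- Terms are in de Bruijn form (hence up to α-conversion); `Term k` has
-- k free variables. A case-binding is a vector indexed by constructors
-- of optional branches: `just u` at position c means (c ↦ u) ∈ θ,
-- `nothing` means c ∉ dom θ (so domains are automatically sets of pairwise
-- distinct constructors, and k = 0 entries is allowed).
module LC (m : ℕ) where

  Con : Set
  Con = Fin (suc m)

  data Term (k : ℕ) : Set where
    var  : Fin k → Term k
    app  : Term k → Term k → Term k
    lam  : Term (suc k) → Term k
    con  : Con → Term k
    case : Vec (Maybe (Term k)) (suc m) → Term k → Term k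

  Binds : ℕ → Set
  Binds k = Vec (Maybe (Term k)) (suc m)

  ext : ∀ {k l} → (Fin k → Fin l) → Fin (suc k) → Fin (suc l)
  ext ρ zero    = zero
  ext ρ (suc i) = suc (ρ i)

  mutual
    ren : ∀ {k l} → (Fin k → Fin l) → Term k → Term l
    ren ρ (var i)    = var (ρ i)
    ren ρ (app t u)  = app (ren ρ t) (ren ρ u)
    ren ρ (lam t)    = lam (ren (ext ρ) t)
    ren ρ (con c)    = con c
    ren ρ (case θ t) = case (renB ρ θ) (ren ρ t)

    renB : ∀ {k l j} → (Fin k → Fin l) → Vec (Maybe (Term k)) j → Vec (Maybe (Term l)) j
    renB ρ []             = []
    renB ρ (nothing ∷ θ)  = nothing ∷ renB ρ θ
    renB ρ (just t ∷ θ)   = just (ren ρ t) ∷ renB ρ θ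

  exts : ∀ {k l} → (Fin k → Term l) → Fin (suc k) → Term (suc l)
  exts σ zero    = var zero
  exts σ (suc i) = ren suc (σ i)

  mutual
    sub : ∀ {k l} → (Fin k → Term l) → Term k → Term l
    sub σ (var i)    = σ i
    sub σ (app t u)  = app (sub σ t) (sub σ u)
    sub σ (lam t)    = lam (sub (exts σ) t)
    sub σ (con c)    = con c
    sub σ (case θ t) = case (subB σ θ) (sub σ t)

    subB : ∀ {k l j} → (Fin k → Term l) → Vec (Maybe (Term k)) j → Vec (Maybe (Term l)) j
    subB σ []             = []
    subB σ (nothing ∷ θ)  = nothing ∷ subB σ θ
    subB σ (just t ∷ θ)   = just (sub σ t) ∷ subB σ θ

  single : ∀ {k} → Term k → Fin (suc k) → Term k
  single u zero    = u
  single u (suc i) = var i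

  _[_] : ∀ {k} → Term (suc k) → Term k → Term k
  t [ u ] = sub (single u) t

  _∘B_ : ∀ {k} → Binds k → Binds k → Binds k
  θ ∘B φ = Vec.map (Maybe.map (case θ)) φ

  data Root : ∀ {k} → Term k → Term k → Set where
    appLam   : ∀ {k} {t : Term (suc k)} {u : Term k} → Root (app (lam t) u) (t [ u ])
    -- λx. t x → t with x ∉ FV(t): t is the weakening of a term
    lamApp   : ∀ {k} {t : Term k} → Root (lam (app (ren suc t) (var zero))) t
    caseCons : ∀ {k} {θ : Binds k} {c : Con} {u : Term k} →
               lookup θ c ≡ just u → Root (case θ (con c)) u
    caseApp  : ∀ {k} {θ : Binds k} {t u : Term k} →
               Root (case θ (app t u)) (app (case θ t) u)
    -- x ∉ FV(θ): the bound variable is fresh for the weakened θ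
    caseLam  : ∀ {k} {θ : Binds k} {t : Term (suc k)} →
               Root (case θ (lam t)) (lam (case (renB suc θ) t))
    caseCase : ∀ {k} {θ φ : Binds k} {t : Term k} →
               Root (case θ (case φ t)) (case (θ ∘B φ) t)

  data CaseCaseRoot : ∀ {k} → Term k → Term k → Set where
    caseCase : ∀ {k} {θ φ : Binds k} {t : Term k} →
               CaseCaseRoot (case θ (case φ t)) (case (θ ∘B φ) t)

  RootRel : Set₁
  RootRel = ∀ {k} → Term k → Term k → Set

  mutual
    data Ctx (R : RootRel) : ∀ {k} → Term k → Term k → Set where
      root  : ∀ {k} {t t' : Term k} → R t t' → Ctx R t t'
      appl  : ∀ {k} {t t' u : Term k} → Ctx R t t' → Ctx R (app t u) (app t' u)
      appr  : ∀ {k} {t u u' : Term k} → Ctx R u u' → Ctx R (app t u) (app t u')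
      lamc  : ∀ {k} {t t' : Term (suc k)} → Ctx R t t' → Ctx R (lam t) (lam t')
      caset : ∀ {k} {θ : Binds k} {t t' : Term k} → Ctx R t t' → Ctx R (case θ t) (case θ t')
      caseb : ∀ {k} {θ θ' : Binds k} {t : Term k} → CtxB R θ θ' → Ctx R (case θ t) (case θ' t)

    data CtxB (R : RootRel) : ∀ {k j} → Vec (Maybe (Term k)) j → Vec (Maybe (Term k)) j → Set where
      here  : ∀ {k j} {t t' : Term k} {θ : Vec (Maybe (Term k)) j} →
              Ctx R t t' → CtxB R (just t ∷ θ) (just t' ∷ θ)
      there : ∀ {k j} {o : Maybe (Term k)} {θ θ' : Vec (Maybe (Term k)) j} →
              CtxB R θ θ' → CtxB R (o ∷ θ) (o ∷ θ')

  _⟶_ : ∀ {k} → Term k → Term k → Set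
  _⟶_ = Ctx Root

  _⟶*_ : ∀ {k} → Term k → Term k → Set
  _⟶*_ = Star _⟶_

  _⟶c_ : ∀ {k} → Term k → Term k → Set
  _⟶c_ = Ctx CaseCaseRoot

  _⟶c*_ : ∀ {k} → Term k → Term k → Set
  _⟶c*_ = Star _⟶c_

  NormalC : ∀ {k} → Term k → Set
  NormalC t = ¬ ∃ (λ t' → t ⟶c t')

  -- t ↓≡ u : u is the (unique, by confluence + SN of CaseCase) CaseCase
  -- normal form of t, i.e. t↓ = u.
  _↓≡_ : ∀ {k} → Term k → Term k → Set
  t ↓≡ u = (t ⟶c* u) × NormalC u

  -- t contains a match failure {θ}·c with c ∉ dom θ as a subterm
  mutual
    data HasMF : ∀ {k} → Term k → Set where
      mf    : ∀ {k} {θ : Binds k} {c : Con} → lookup θ c ≡ nothing → HasMF (case θ (con c))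
      appl  : ∀ {k} {t u : Term k} → HasMF t → HasMF (app t u)
      appr  : ∀ {k} {t u : Term k} → HasMF u → HasMF (app t u)
      lamc  : ∀ {k} {t : Term (suc k)} → HasMF t → HasMF (lam t)
      caset : ∀ {k} {θ : Binds k} {t : Term k} → HasMF t → HasMF (case θ t)
      caseb : ∀ {k} {θ : Binds k} {t : Term k} → HasMFB θ → HasMF (case θ t)

    data HasMFB : ∀ {k j} → Vec (Maybe (Term k)) j → Set where
      here  : ∀ {k j} {t : Term k} {θ : Vec (Maybe (Term k)) j} → HasMF t → HasMFB (just t ∷ θ)
      there : ∀ {k j} {o : Maybe (Term k)} {θ : Vec (Maybe (Term k)) j} → HasMFB θ → HasMFB (o ∷ θ)

  Defined : ∀ {k} → Term k → Set
  Defined t = ¬ HasMF t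

  HerDefined : ∀ {k} → Term k → Set
  HerDefined t = ∀ t' → t ⟶* t' → Defined t'

  emptyFail : ∀ {k} → Term k
  emptyFail = case (replicate (suc m) nothing) (con zero)

  mutual
    bar : ∀ {k} → Term k → Term k
    bar (var i)    = var i
    bar (app t u)  = app (bar t) (bar u)
    bar (lam t)    = lam (bar t)
    bar (con c)    = con c
    bar (case θ t) = case (barB θ) (bar t)

    barB : ∀ {k j} → Vec (Maybe (Term k)) j → Vec (Maybe (Term k)) j
    barB []            = []
    barB (nothing ∷ θ) = just emptyFail ∷ barB θ
    barB (just u ∷ θ)  = just (bar u) ∷ barB θ

-- Completion only adds branches whose bodies are junk: a stack of case-bindings
-- over the match failure {}·c₁.  Relate s to u when u is s with some missing
-- branches filled by junk (so t is related to bar t).  Every step of u is then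
-- matched by at most one step of s, provided s is defined: the only steps
-- without a counterpart are a CaseCons into a filled branch, which would expose
-- a match failure in s, and steps inside junk, which leave it junk.  As s
-- stays a reduct of t, hereditary definedness keeps this going.  Junk
-- CaseCase-normalises to {}·c₁, which is exactly the filler used by bar, so
-- u↓ = bar (s↓) for related s and u; the witness t₀ is s↓.
module Submission where

open import Defs
open import Data.Nat using (ℕ; zero; suc)
open import Data.Fin using (Fin; zero; suc)
open import Data.Maybe using (Maybe; just; nothing)
import Data.Maybe as Maybe
open import Data.Vec using (Vec; []; _∷_; lookup; replicate)
import Data.Vec as Vec
open import Data.Vec.Properties using (lookup-replicate)
open import Data.Vec.Relation.Unary.All using (All; []; _∷_)
open import Data.Vec.Relation.Unary.All.Properties using (lookup⁺; lookup⁻)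
open import Data.Product using (Σ; _×_; _,_)
open import Data.Sum using (_⊎_; inj₁; inj₂)
open import Data.Empty using (⊥; ⊥-elim)
open import Data.Unit using (⊤; tt)
open import Relation.Nullary using (¬_)
open import Relation.Binary.PropositionalEquality using (_≡_; _≢_; refl; sym; trans; cong; cong₂; subst)
open import Relation.Binary.Construct.Closure.ReflexiveTransitive using (Star; ε; _◅_; _◅◅_; gmap; return)
import Relation.Binary.Construct.Closure.ReflexiveTransitive as Star

module Completion (m : ℕ) where
  open LC m

  Branchless : ∀ {k j} → Vec (Maybe (Term k)) j → Set
  Branchless = All (_≡ nothing)

  Branchless-replicate : ∀ {k} j → Branchless {k} (replicate j nothing)
  Branchless-replicate j = lookup⁻ (λ i → lookup-replicate i nothing)

  Branchless-map : ∀ {k j} (f : Term k → Term k) {θ : Vec (Maybe (Term k)) j} →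
                   Branchless θ → Branchless (Vec.map (Maybe.map f) θ)
  Branchless-map f []         = []
  Branchless-map f (refl ∷ b) = refl ∷ Branchless-map f b

  Branchless-renB : ∀ {k l j} (ρ : Fin k → Fin l) {θ : Vec (Maybe (Term k)) j} →
                    Branchless θ → Branchless (renB ρ θ)
  Branchless-renB ρ []         = []
  Branchless-renB ρ (refl ∷ b) = refl ∷ Branchless-renB ρ b

  Branchless-renB⁻¹ : ∀ {k l j} (ρ : Fin k → Fin l) (θ : Vec (Maybe (Term k)) j) →
                      Branchless (renB ρ θ) → Branchless θ
  Branchless-renB⁻¹ ρ []            []         = []
  Branchless-renB⁻¹ ρ (nothing ∷ θ) (refl ∷ b) = refl ∷ Branchless-renB⁻¹ ρ θ b
  Branchless-renB⁻¹ ρ (just _ ∷ θ)  (() ∷ _)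

  Branchless-subB : ∀ {k l j} (σ : Fin k → Term l) {θ : Vec (Maybe (Term k)) j} →
                    Branchless θ → Branchless (subB σ θ)
  Branchless-subB σ []         = []
  Branchless-subB σ (refl ∷ b) = refl ∷ Branchless-subB σ b

  Branchless-lookup≢just : ∀ {k j} {θ : Vec (Maybe (Term k)) j} (c : Fin j) {u : Term k} →
                           Branchless θ → lookup θ c ≢ just u
  Branchless-lookup≢just c b e with trans (sym e) (lookup⁺ b c)
  ... | ()

  Branchless-¬CtxB : ∀ {R : RootRel} {k j} {θ θ' : Vec (Maybe (Term k)) j} →
                     Branchless θ → ¬ CtxB R θ θ'
  Branchless-¬CtxB (refl ∷ b) (there r) = Branchless-¬CtxB b r

  Branchless⇒≡replicate : ∀ {k j} {θ : Vec (Maybe (Term k)) j} → Branchless θ → θ ≡ replicate j nothing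
  Branchless⇒≡replicate []         = refl
  Branchless⇒≡replicate (refl ∷ b) = cong (nothing ∷_) (Branchless⇒≡replicate b)

  data Junk {k : ℕ} : Term k → Set where
    failure   : ∀ {θ : Binds k} → Branchless θ → Junk (case θ (con zero))
    case-junk : ∀ {θ : Binds k} {t : Term k} → Junk t → Junk (case θ t)

  Junk-emptyFail : ∀ {k} → Junk {k} emptyFail
  Junk-emptyFail = failure (Branchless-replicate (suc m))

  Junk-ren : ∀ {k l} (ρ : Fin k → Fin l) {t : Term k} → Junk t → Junk (ren ρ t)
  Junk-ren ρ (failure b)   = failure (Branchless-renB ρ b)
  Junk-ren ρ (case-junk j) = case-junk (Junk-ren ρ j)

  Junk-ren⁻¹ : ∀ {k l} (ρ : Fin k → Fin l) (t : Term k) → Junk (ren ρ t) → Junk t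
  Junk-ren⁻¹ ρ (case θ (con zero)) (failure b)   = failure (Branchless-renB⁻¹ ρ θ b)
  Junk-ren⁻¹ ρ (case θ t)          (case-junk j) = case-junk (Junk-ren⁻¹ ρ t j)

  Junk-sub : ∀ {k l} (σ : Fin k → Term l) {t : Term k} → Junk t → Junk (sub σ t)
  Junk-sub σ (failure b)   = failure (Branchless-subB σ b)
  Junk-sub σ (case-junk j) = case-junk (Junk-sub σ j)

  Junk-⟶ : ∀ {k} {t t' : Term k} → Junk t → t ⟶ t' → Junk t'
  Junk-⟶ (failure b) (root (caseCons {c = c} e)) = ⊥-elim (Branchless-lookup≢just c b e)
  Junk-⟶ (failure b) (caset (root ()))
  Junk-⟶ (failure b) (caseb r)                   = ⊥-elim (Branchless-¬CtxB b r)
  Junk-⟶ (case-junk ()) (root (caseCons _))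
  Junk-⟶ (case-junk ()) (root caseApp)
  Junk-⟶ (case-junk ()) (root caseLam)
  Junk-⟶ {t = case θ _} (case-junk (failure b)) (root caseCase) = failure (Branchless-map (case θ) b)
  Junk-⟶ (case-junk (case-junk j)) (root caseCase) = case-junk j
  Junk-⟶ (case-junk j) (caset r) = case-junk (Junk-⟶ j r)
  Junk-⟶ (case-junk j) (caseb r) = case-junk j

  infix 4 _⊑_ _⊑B_

  mutual
    data _⊑_ {k : ℕ} : Term k → Term k → Set where
      ⊑var  : ∀ {i} → var i ⊑ var i
      ⊑app  : ∀ {t t' u u'} → t ⊑ t' → u ⊑ u' → app t u ⊑ app t' u'
      ⊑lam  : ∀ {t t' : Term (suc k)} → t ⊑ t' → lam t ⊑ lam t'
      ⊑con  : ∀ {c} → con c ⊑ con c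
      ⊑case : ∀ {θ θ' t t'} → θ ⊑B θ' → t ⊑ t' → case θ t ⊑ case θ' t'

    data _⊑B_ {k : ℕ} : ∀ {j} → Vec (Maybe (Term k)) j → Vec (Maybe (Term k)) j → Set where
      ⊑[]    : [] ⊑B []
      ⊑junk  : ∀ {j u} {θ θ' : Vec (Maybe (Term k)) j} →
               Junk u → θ ⊑B θ' → nothing ∷ θ ⊑B just u ∷ θ'
      ⊑just  : ∀ {j t t'} {θ θ' : Vec (Maybe (Term k)) j} →
               t ⊑ t' → θ ⊑B θ' → just t ∷ θ ⊑B just t' ∷ θ'

  mutual
    ⊑-bar : ∀ {k} (t : Term k) → t ⊑ bar t
    ⊑-bar (var i)    = ⊑var
    ⊑-bar (app t u)  = ⊑app (⊑-bar t) (⊑-bar u)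
    ⊑-bar (lam t)    = ⊑lam (⊑-bar t)
    ⊑-bar (con c)    = ⊑con
    ⊑-bar (case θ t) = ⊑case (⊑B-barB θ) (⊑-bar t)

    ⊑B-barB : ∀ {k j} (θ : Vec (Maybe (Term k)) j) → θ ⊑B barB θ
    ⊑B-barB []            = ⊑[]
    ⊑B-barB (nothing ∷ θ) = ⊑junk Junk-emptyFail (⊑B-barB θ)
    ⊑B-barB (just t ∷ θ)  = ⊑just (⊑-bar t) (⊑B-barB θ)

  mutual
    ⊑-ren : ∀ {k l} (ρ : Fin k → Fin l) {t t'} → t ⊑ t' → ren ρ t ⊑ ren ρ t'
    ⊑-ren ρ ⊑var          = ⊑var
    ⊑-ren ρ (⊑app s s')   = ⊑app (⊑-ren ρ s) (⊑-ren ρ s')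
    ⊑-ren ρ (⊑lam s)      = ⊑lam (⊑-ren (ext ρ) s)
    ⊑-ren ρ ⊑con          = ⊑con
    ⊑-ren ρ (⊑case sθ s)  = ⊑case (⊑B-renB ρ sθ) (⊑-ren ρ s)

    ⊑B-renB : ∀ {k l j} (ρ : Fin k → Fin l) {θ θ' : Vec (Maybe (Term k)) j} →
              θ ⊑B θ' → renB ρ θ ⊑B renB ρ θ'
    ⊑B-renB ρ ⊑[]          = ⊑[]
    ⊑B-renB ρ (⊑junk j sθ) = ⊑junk (Junk-ren ρ j) (⊑B-renB ρ sθ)
    ⊑B-renB ρ (⊑just s sθ) = ⊑just (⊑-ren ρ s) (⊑B-renB ρ sθ)

  mutual
    ⊑-ren⁻¹ : ∀ {k l} (ρ : Fin k → Fin l) (t' : Term k) {s} → s ⊑ ren ρ t' →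
              Σ (Term k) λ t → (s ≡ ren ρ t) × t ⊑ t'
    ⊑-ren⁻¹ ρ (var i) ⊑var = var i , refl , ⊑var
    ⊑-ren⁻¹ ρ (app t' u') (⊑app s s')
      with ⊑-ren⁻¹ ρ t' s | ⊑-ren⁻¹ ρ u' s'
    ... | t , refl , t⊑ | u , refl , u⊑ = app t u , refl , ⊑app t⊑ u⊑
    ⊑-ren⁻¹ ρ (lam t') (⊑lam s) with ⊑-ren⁻¹ (ext ρ) t' s
    ... | t , refl , t⊑ = lam t , refl , ⊑lam t⊑
    ⊑-ren⁻¹ ρ (con c) ⊑con = con c , refl , ⊑con
    ⊑-ren⁻¹ ρ (case θ' t') (⊑case sθ s)
      with ⊑B-renB⁻¹ ρ θ' sθ | ⊑-ren⁻¹ ρ t' s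
    ... | θ , refl , θ⊑ | t , refl , t⊑ = case θ t , refl , ⊑case θ⊑ t⊑

    ⊑B-renB⁻¹ : ∀ {k l j} (ρ : Fin k → Fin l) (θ' : Vec (Maybe (Term k)) j) {φ} →
                φ ⊑B renB ρ θ' → Σ (Vec (Maybe (Term k)) j) λ θ → (φ ≡ renB ρ θ) × θ ⊑B θ'
    ⊑B-renB⁻¹ ρ [] ⊑[] = [] , refl , ⊑[]
    ⊑B-renB⁻¹ ρ (just u ∷ θ') (⊑junk j sθ) with ⊑B-renB⁻¹ ρ θ' sθ
    ... | θ , refl , θ⊑ = nothing ∷ θ , refl , ⊑junk (Junk-ren⁻¹ ρ u j) θ⊑
    ⊑B-renB⁻¹ ρ (just t' ∷ θ') (⊑just s sθ)
      with ⊑-ren⁻¹ ρ t' s | ⊑B-renB⁻¹ ρ θ' sθ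
    ... | t , refl , t⊑ | θ , refl , θ⊑ = just t ∷ θ , refl , ⊑just t⊑ θ⊑

  ⊑-exts : ∀ {k l} {σ τ : Fin k → Term l} → (∀ i → σ i ⊑ τ i) → ∀ i → exts σ i ⊑ exts τ i
  ⊑-exts s zero    = ⊑var
  ⊑-exts s (suc i) = ⊑-ren suc (s i)

  mutual
    ⊑-sub : ∀ {k l} {σ τ : Fin k → Term l} → (∀ i → σ i ⊑ τ i) → ∀ {t t'} → t ⊑ t' → sub σ t ⊑ sub τ t'
    ⊑-sub s (⊑var {i})    = s i
    ⊑-sub s (⊑app t⊑ u⊑)  = ⊑app (⊑-sub s t⊑) (⊑-sub s u⊑)
    ⊑-sub s (⊑lam t⊑)     = ⊑lam (⊑-sub (⊑-exts s) t⊑)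
    ⊑-sub s ⊑con          = ⊑con
    ⊑-sub s (⊑case sθ t⊑) = ⊑case (⊑B-subB s sθ) (⊑-sub s t⊑)

    ⊑B-subB : ∀ {k l j} {σ τ : Fin k → Term l} → (∀ i → σ i ⊑ τ i) →
              {θ θ' : Vec (Maybe (Term k)) j} → θ ⊑B θ' → subB σ θ ⊑B subB τ θ'
    ⊑B-subB s ⊑[]           = ⊑[]
    ⊑B-subB {τ = τ} s (⊑junk j sθ) = ⊑junk (Junk-sub τ j) (⊑B-subB s sθ)
    ⊑B-subB s (⊑just t⊑ sθ) = ⊑just (⊑-sub s t⊑) (⊑B-subB s sθ)

  ⊑-[] : ∀ {k} {t t' : Term (suc k)} {u u' : Term k} → t ⊑ t' → u ⊑ u' → t [ u ] ⊑ t' [ u' ]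
  ⊑-[] t⊑ u⊑ = ⊑-sub (λ { zero → u⊑ ; (suc i) → ⊑var }) t⊑

  ⊑B-lookup : ∀ {k j} {θ θ' : Vec (Maybe (Term k)) j} → θ ⊑B θ' → ∀ c {u'} → lookup θ' c ≡ just u' →
              lookup θ c ≡ nothing ⊎ Σ (Term k) λ u → (lookup θ c ≡ just u) × u ⊑ u'
  ⊑B-lookup (⊑junk _ _)  zero    _    = inj₁ refl
  ⊑B-lookup (⊑just s _)  zero    refl = inj₂ (_ , refl , s)
  ⊑B-lookup (⊑junk _ sθ) (suc c) e    = ⊑B-lookup sθ c e
  ⊑B-lookup (⊑just _ sθ) (suc c) e    = ⊑B-lookup sθ c e

  ⊑B-∘B : ∀ {k} {θ θ' φ φ' : Binds k} → θ ⊑B θ' → φ ⊑B φ' → θ ∘B φ ⊑B θ' ∘B φ'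
  ⊑B-∘B {θ = θ} {θ'} sθ = go
    where
    go : ∀ {j} {φ φ' : Vec (Maybe (Term _)) j} → φ ⊑B φ' →
         Vec.map (Maybe.map (case θ)) φ ⊑B Vec.map (Maybe.map (case θ')) φ'
    go ⊑[]          = ⊑[]
    go (⊑junk j sφ) = ⊑junk (case-junk j) (go sφ)
    go (⊑just s sφ) = ⊑just (⊑case sθ s) (go sφ)

  mutual
    simulate : ∀ {k} {s u u' : Term k} → Defined s → s ⊑ u → u ⟶ u' →
               Σ (Term k) λ s' → (s ⟶* s') × s' ⊑ u'
    simulate d (⊑app (⊑lam t⊑) u⊑) (root appLam) = _ , return (root appLam) , ⊑-[] t⊑ u⊑
    simulate d (⊑lam (⊑app t⊑ ⊑var)) (root (lamApp {t = t'})) with ⊑-ren⁻¹ suc t' t⊑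
    ... | t , refl , t⊑t' = t , return (root lamApp) , t⊑t'
    simulate d (⊑case sθ ⊑con) (root (caseCons {c = c} e)) with ⊑B-lookup sθ c e
    ... | inj₁ missing       = ⊥-elim (d (mf missing))
    ... | inj₂ (u , e' , u⊑) = u , return (root (caseCons e')) , u⊑
    simulate d (⊑case sθ (⊑app t⊑ u⊑)) (root caseApp) =
      _ , return (root caseApp) , ⊑app (⊑case sθ t⊑) u⊑
    simulate d (⊑case sθ (⊑lam t⊑)) (root caseLam) =
      _ , return (root caseLam) , ⊑lam (⊑case (⊑B-renB suc sθ) t⊑)
    simulate d (⊑case sθ (⊑case sφ t⊑)) (root caseCase) =
      _ , return (root caseCase) , ⊑case (⊑B-∘B sθ sφ) t⊑
    simulate d (⊑app t⊑ u⊑) (appl r) with simulate (λ f → d (appl f)) t⊑ r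
    ... | _ , rs , t⊑' = _ , gmap (λ x → app x _) appl rs , ⊑app t⊑' u⊑
    simulate d (⊑app t⊑ u⊑) (appr r) with simulate (λ f → d (appr f)) u⊑ r
    ... | _ , rs , u⊑' = _ , gmap (app _) appr rs , ⊑app t⊑ u⊑'
    simulate d (⊑lam t⊑) (lamc r) with simulate (λ f → d (lamc f)) t⊑ r
    ... | _ , rs , t⊑' = _ , gmap lam lamc rs , ⊑lam t⊑'
    simulate d (⊑case sθ t⊑) (caset r) with simulate (λ f → d (caset f)) t⊑ r
    ... | _ , rs , t⊑' = _ , gmap (case _) caset rs , ⊑case sθ t⊑'
    simulate d (⊑case sθ t⊑) (caseb r) with simulateB (λ f → d (caseb f)) sθ r
    ... | _ , rs , sθ' = _ , gmap (λ x → case x _) caseb rs , ⊑case sθ' t⊑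

    simulateB : ∀ {k j} {θ φ φ' : Vec (Maybe (Term k)) j} → ¬ HasMFB θ → θ ⊑B φ → CtxB Root φ φ' →
                Σ (Vec (Maybe (Term k)) j) λ θ' → Star (CtxB Root) θ θ' × θ' ⊑B φ'
    simulateB d (⊑junk j sθ) (here r) = _ , ε , ⊑junk (Junk-⟶ j r) sθ
    simulateB d (⊑just s sθ) (here r) with simulate (λ f → d (here f)) s r
    ... | _ , rs , s' = _ , gmap (λ x → just x ∷ _) here rs , ⊑just s' sθ
    simulateB d (⊑junk j sθ) (there r) with simulateB (λ f → d (there f)) sθ r
    ... | _ , rs , sθ' = _ , gmap (nothing ∷_) there rs , ⊑junk j sθ'
    simulateB d (⊑just s sθ) (there r) with simulateB (λ f → d (there f)) sθ r
    ... | _ , rs , sθ' = _ , gmap (just _ ∷_) there rs , ⊑just s sθ'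

  simulate* : ∀ {k} {s u u' : Term k} → HerDefined s → s ⊑ u → u ⟶* u' →
              Σ (Term k) λ s' → (s ⟶* s') × s' ⊑ u'
  simulate* hd s⊑ ε = _ , ε , s⊑
  simulate* hd s⊑ (r ◅ rs) with simulate (hd _ ε) s⊑ r
  ... | s₁ , r₁ , s₁⊑ with simulate* (λ t rs' → hd t (r₁ ◅◅ rs')) s₁⊑ rs
  ... | s₂ , r₂ , s₂⊑ = s₂ , r₁ ◅◅ r₂ , s₂⊑

  -- case↓ θ u is the CaseCase normal form of {θ}·u when θ and u are normal.
  mutual
    case↓ : ∀ {k} → Binds k → Term k → Term k
    case↓ θ (case φ t) = case (case↓B θ φ) t
    case↓ θ t          = case θ t

    case↓B : ∀ {k j} → Binds k → Vec (Maybe (Term k)) j → Vec (Maybe (Term k)) j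
    case↓B θ []            = []
    case↓B θ (nothing ∷ φ) = nothing ∷ case↓B θ φ
    case↓B θ (just t ∷ φ)  = just (case↓ θ t) ∷ case↓B θ φ

  mutual
    nf : ∀ {k} → Term k → Term k
    nf (var i)    = var i
    nf (app t u)  = app (nf t) (nf u)
    nf (lam t)    = lam (nf t)
    nf (con c)    = con c
    nf (case θ t) = case↓ (nfB θ) (nf t)

    nfB : ∀ {k j} → Vec (Maybe (Term k)) j → Vec (Maybe (Term k)) j
    nfB []            = []
    nfB (nothing ∷ θ) = nothing ∷ nfB θ
    nfB (just t ∷ θ)  = just (nf t) ∷ nfB θ

  _⟶cB*_ : ∀ {k j} → Vec (Maybe (Term k)) j → Vec (Maybe (Term k)) j → Set
  _⟶cB*_ = Star (CtxB CaseCaseRoot)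

  mutual
    case↓-reduces : ∀ {k} (θ : Binds k) (t : Term k) → case θ t ⟶c* case↓ θ t
    case↓-reduces θ (var i)    = ε
    case↓-reduces θ (app t u)  = ε
    case↓-reduces θ (lam t)    = ε
    case↓-reduces θ (con c)    = ε
    case↓-reduces θ (case φ t) = root caseCase ◅ gmap (λ ψ → case ψ t) caseb (case↓B-reduces θ φ)

    case↓B-reduces : ∀ {k j} (θ : Binds k) (φ : Vec (Maybe (Term k)) j) →
                     Vec.map (Maybe.map (case θ)) φ ⟶cB* case↓B θ φ
    case↓B-reduces θ []            = ε
    case↓B-reduces θ (nothing ∷ φ) = gmap (nothing ∷_) there (case↓B-reduces θ φ)
    case↓B-reduces θ (just t ∷ φ)  =
      gmap (λ x → just x ∷ _) here (case↓-reduces θ t) ◅◅ gmap (just _ ∷_) there (case↓B-reduces θ φ)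

  mutual
    nf-reduces : ∀ {k} (t : Term k) → t ⟶c* nf t
    nf-reduces (var i)    = ε
    nf-reduces (app t u)  = gmap (λ x → app x u) appl (nf-reduces t) ◅◅ gmap (app _) appr (nf-reduces u)
    nf-reduces (lam t)    = gmap lam lamc (nf-reduces t)
    nf-reduces (con c)    = ε
    nf-reduces (case θ t) = gmap (λ x → case x t) caseb (nfB-reduces θ)
                            ◅◅ gmap (case _) caset (nf-reduces t)
                            ◅◅ case↓-reduces (nfB θ) (nf t)

    nfB-reduces : ∀ {k j} (θ : Vec (Maybe (Term k)) j) → θ ⟶cB* nfB θ
    nfB-reduces []            = ε
    nfB-reduces (nothing ∷ θ) = gmap (nothing ∷_) there (nfB-reduces θ)
    nfB-reduces (just t ∷ θ)  =
      gmap (λ x → just x ∷ θ) here (nf-reduces t) ◅◅ gmap (just _ ∷_) there (nfB-reduces θ)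

  NotCase : ∀ {k} → Term k → Set
  NotCase (case _ _) = ⊥
  NotCase _          = ⊤

  mutual
    data Nf {k : ℕ} : Term k → Set where
      var  : ∀ {i} → Nf (var i)
      app  : ∀ {t u} → Nf t → Nf u → Nf (app t u)
      lam  : ∀ {t : Term (suc k)} → Nf t → Nf (lam t)
      con  : ∀ {c} → Nf (con c)
      case : ∀ {θ t} → NfB θ → Nf t → NotCase t → Nf (case θ t)

    data NfB {k : ℕ} : ∀ {j} → Vec (Maybe (Term k)) j → Set where
      []      : NfB []
      nothing : ∀ {j} {θ : Vec (Maybe (Term k)) j} → NfB θ → NfB (nothing ∷ θ)
      just    : ∀ {j t} {θ : Vec (Maybe (Term k)) j} → Nf t → NfB θ → NfB (just t ∷ θ)

  mutual
    Nf-case↓ : ∀ {k} {θ : Binds k} {t} → NfB θ → Nf t → Nf (case↓ θ t)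
    Nf-case↓ nθ var              = case nθ var tt
    Nf-case↓ nθ (app nt nu)      = case nθ (app nt nu) tt
    Nf-case↓ nθ (lam nt)         = case nθ (lam nt) tt
    Nf-case↓ nθ con              = case nθ con tt
    Nf-case↓ nθ (case nφ nt nc)  = case (NfB-case↓B nθ nφ) nt nc

    NfB-case↓B : ∀ {k j} {θ : Binds k} {φ : Vec (Maybe (Term k)) j} → NfB θ → NfB φ → NfB (case↓B θ φ)
    NfB-case↓B nθ []            = []
    NfB-case↓B nθ (nothing nφ)  = nothing (NfB-case↓B nθ nφ)
    NfB-case↓B nθ (just nt nφ)  = just (Nf-case↓ nθ nt) (NfB-case↓B nθ nφ)

  mutual
    Nf-nf : ∀ {k} (t : Term k) → Nf (nf t)
    Nf-nf (var i)    = var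
    Nf-nf (app t u)  = app (Nf-nf t) (Nf-nf u)
    Nf-nf (lam t)    = lam (Nf-nf t)
    Nf-nf (con c)    = con
    Nf-nf (case θ t) = Nf-case↓ (NfB-nfB θ) (Nf-nf t)

    NfB-nfB : ∀ {k j} (θ : Vec (Maybe (Term k)) j) → NfB (nfB θ)
    NfB-nfB []            = []
    NfB-nfB (nothing ∷ θ) = nothing (NfB-nfB θ)
    NfB-nfB (just t ∷ θ)  = just (Nf-nf t) (NfB-nfB θ)

  mutual
    Nf-¬⟶c : ∀ {k} {t t' : Term k} → Nf t → ¬ t ⟶c t'
    Nf-¬⟶c (case _ _ ()) (root caseCase)
    Nf-¬⟶c (app nt _)    (appl r)  = Nf-¬⟶c nt r
    Nf-¬⟶c (app _ nu)    (appr r)  = Nf-¬⟶c nu r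
    Nf-¬⟶c (lam nt)      (lamc r)  = Nf-¬⟶c nt r
    Nf-¬⟶c (case _ nt _) (caset r) = Nf-¬⟶c nt r
    Nf-¬⟶c (case nθ _ _) (caseb r) = NfB-¬⟶c nθ r

    NfB-¬⟶c : ∀ {k j} {θ θ' : Vec (Maybe (Term k)) j} → NfB θ → ¬ CtxB CaseCaseRoot θ θ'
    NfB-¬⟶c (just nt _)  (here r)  = Nf-¬⟶c nt r
    NfB-¬⟶c (nothing nθ) (there r) = NfB-¬⟶c nθ r
    NfB-¬⟶c (just _ nθ)  (there r) = NfB-¬⟶c nθ r

  nf-↓ : ∀ {k} (t : Term k) → t ↓≡ nf t
  nf-↓ t = nf-reduces t , λ (_ , r) → Nf-¬⟶c (Nf-nf t) r

  case↓-emptyFail : ∀ {k} (θ : Binds k) → case↓ θ emptyFail ≡ emptyFail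
  case↓-emptyFail θ = cong (λ φ → case φ (con zero)) (go (suc m))
    where
    go : ∀ j → case↓B θ (replicate j nothing) ≡ replicate j nothing
    go zero    = refl
    go (suc j) = cong (nothing ∷_) (go j)

  nf-Junk : ∀ {k} {t : Term k} → Junk t → nf t ≡ emptyFail
  nf-Junk (failure b) = cong (λ φ → case φ (con zero)) (Branchless⇒≡replicate (Branchless-nfB b))
    where
    Branchless-nfB : ∀ {k j} {θ : Vec (Maybe (Term k)) j} → Branchless θ → Branchless (nfB θ)
    Branchless-nfB []         = []
    Branchless-nfB (refl ∷ b) = refl ∷ Branchless-nfB b
  nf-Junk (case-junk {θ = θ} j) = trans (cong (case↓ (nfB θ)) (nf-Junk j)) (case↓-emptyFail (nfB θ))

  mutual
    case↓-bar : ∀ {k} (θ : Binds k) (t : Term k) → case↓ (barB θ) (bar t) ≡ bar (case↓ θ t)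
    case↓-bar θ (var i)    = refl
    case↓-bar θ (app t u)  = refl
    case↓-bar θ (lam t)    = refl
    case↓-bar θ (con c)    = refl
    case↓-bar θ (case φ t) = cong (λ ψ → case ψ (bar t)) (case↓B-barB θ φ)

    case↓B-barB : ∀ {k j} (θ : Binds k) (φ : Vec (Maybe (Term k)) j) →
                  case↓B (barB θ) (barB φ) ≡ barB (case↓B θ φ)
    case↓B-barB θ []            = refl
    case↓B-barB θ (nothing ∷ φ) = cong₂ _∷_ (cong just (case↓-emptyFail (barB θ))) (case↓B-barB θ φ)
    case↓B-barB θ (just t ∷ φ)  = cong₂ _∷_ (cong just (case↓-bar θ t)) (case↓B-barB θ φ)

  mutual
    nf-⊑ : ∀ {k} {s u : Term k} → s ⊑ u → nf u ≡ bar (nf s)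
    nf-⊑ ⊑var           = refl
    nf-⊑ (⊑app t⊑ u⊑)   = cong₂ app (nf-⊑ t⊑) (nf-⊑ u⊑)
    nf-⊑ (⊑lam t⊑)      = cong lam (nf-⊑ t⊑)
    nf-⊑ ⊑con           = refl
    nf-⊑ (⊑case {θ = θ} {t = t} sθ t⊑) =
      trans (cong₂ case↓ (nfB-⊑B sθ) (nf-⊑ t⊑)) (case↓-bar (nfB θ) (nf t))

    nfB-⊑B : ∀ {k j} {θ θ' : Vec (Maybe (Term k)) j} → θ ⊑B θ' → nfB θ' ≡ barB (nfB θ)
    nfB-⊑B ⊑[]           = refl
    nfB-⊑B (⊑junk j sθ)  = cong₂ _∷_ (cong just (nf-Junk j)) (nfB-⊑B sθ)
    nfB-⊑B (⊑just t⊑ sθ) = cong₂ _∷_ (cong just (nf-⊑ t⊑)) (nfB-⊑B sθ)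

  mutual
    ⟶c⇒⟶ : ∀ {k} {t t' : Term k} → t ⟶c t' → t ⟶ t'
    ⟶c⇒⟶ (root caseCase) = root caseCase
    ⟶c⇒⟶ (appl r)  = appl (⟶c⇒⟶ r)
    ⟶c⇒⟶ (appr r)  = appr (⟶c⇒⟶ r)
    ⟶c⇒⟶ (lamc r)  = lamc (⟶c⇒⟶ r)
    ⟶c⇒⟶ (caset r) = caset (⟶c⇒⟶ r)
    ⟶c⇒⟶ (caseb r) = caseb (⟶cB⇒⟶B r)

    ⟶cB⇒⟶B : ∀ {k j} {θ θ' : Vec (Maybe (Term k)) j} → CtxB CaseCaseRoot θ θ' → CtxB Root θ θ'
    ⟶cB⇒⟶B (here r)  = here (⟶c⇒⟶ r)
    ⟶cB⇒⟶B (there r) = there (⟶cB⇒⟶B r)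

corollary1 : (m : ℕ) → let open LC m in
    {k : ℕ} (t t' : Term k) → HerDefined t → bar t ⟶* t' →
    Σ (Term k) (λ t₀ → (t ⟶* t₀) × (t' ↓≡ bar t₀))
corollary1 m t t' hd r =
  let s , t⟶*s , s⊑t' = simulate* hd (⊑-bar t) r in
  nf s , t⟶*s ◅◅ Star.map ⟶c⇒⟶ (nf-reduces s) , subst (t' ↓≡_) (nf-⊑ s⊑t') (nf-↓ t')
  where
  open LC m
  open Completion m
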